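{- Let $D(x)=1-28x-84x^2+27x^3$ and define integer sequences by the formal power series expansions \[ \frac{6+184x+54x^2}{D(x)}=\sum_{n\ge0}a_nx^n,\ \frac{14-64x+126x^2}{D(x)}=\sum_{n\ge0}b_nx^n,\ \frac{9-81x^2}{D(x)}=\sum_{n\ge0}c_nx^n, \] \[ \frac{4-36x^2}{D(x)}=\sum_{n\ge0}d_nx^n,\ \frac{15-135x^2}{D(x)}=\sum_{n\ge0}e_nx^n. \] Then for all $n\ge0$, $a_n^4+b_n^4+c_n^4+d_n^4=e_n^4-\big(8\cdot(-3)^n\big)^4$. -}

module Defs where

open import Data.Nat using (ℕ; zero; suc)
open import Data.Integer using (ℤ; +_; -_; _+_; _-_; _*_; _^_)
open import Data.List using (List; []; _∷_)

-- Coefficient list of a polynomial: p₀ ∷ p₁ ∷ ... (lowest degree first).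
Poly : Set
Poly = List ℤ

coeffP : Poly → ℕ → ℤ
coeffP []       _       = + 0
coeffP (p ∷ ps) zero    = p
coeffP (p ∷ ps) (suc n) = coeffP ps n

-- D(x) = 1 - 28x - 84x^2 + 27x^3
-- The formal power series N(x)/D(x) = Σ s_n x^n is the unique series with
-- D(x) · Σ s_n x^n = N(x), i.e. (since D has constant term 1)
--   s_n = N_n + 28 s_{n-1} + 84 s_{n-2} - 27 s_{n-3}   (s_k = 0 for k < 0).
-- serDiv N n returns (s_n , s_{n-1} , s_{n-2}) to make recursion structural.
record Triple : Set where
  constructor ⟨_,_,_⟩
  field
    t₀ t₁ t₂ : ℤ

serDiv : Poly → ℕ → Triple
serDiv N zero    = ⟨ coeffP N 0 , + 0 , + 0 ⟩
serDiv N (suc n) with serDiv N n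
... | ⟨ s₀ , s₁ , s₂ ⟩ =
  ⟨ coeffP N (suc n) + (+ 28) * s₀ + (+ 84) * s₁ - (+ 27) * s₂ , s₀ , s₁ ⟩

coeffDiv : Poly → ℕ → ℤ
coeffDiv N n = Triple.t₀ (serDiv N n)

a b c d e : ℕ → ℤ
a = coeffDiv (+ 6 ∷ + 184 ∷ + 54 ∷ [])
b = coeffDiv (+ 14 ∷ - (+ 64) ∷ + 126 ∷ [])
c = coeffDiv (+ 9 ∷ + 0 ∷ - (+ 81) ∷ [])
d = coeffDiv (+ 4 ∷ + 0 ∷ - (+ 36) ∷ [])
e = coeffDiv (+ 15 ∷ + 0 ∷ - (+ 135) ∷ [])

-- Let φ, ψ be the roots of t² - 5t - 3, so φψ = -3 and φ² + ψ² = 31; then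
-- D(x) = (1 + 3x)(1 - 31x + 9x²) = (1 - φ²x)(1 - φψx)(1 - ψ²x).  Hence every binary
-- quadratic form evaluated at consecutive terms of u (n+1) = 5 u n + 3 u (n-1)
-- obeys the linear recurrence with denominator D, and since a numerator of degree
-- at most 2 is determined by three initial values, each of a, …, e is such a form.
-- The Cassini form of u equals (-3)^n, and the theorem becomes a polynomial
-- identity in two variables.
module Submission where

open import Data.Nat as ℕ using (ℕ; zero; suc)
open import Data.Nat.GeneralisedArithmetic using (fold)
open import Data.Integer using (ℤ; +_; -_; _+_; _-_; _*_; _^_)
open import Data.Integer.Properties using (+-identityˡ; *-identityˡ; *-identityʳ; *-assoc)
open import Data.Integer.Tactic.RingSolver using (solve-∀)
open import Data.Product using (_×_; _,_; proj₁; proj₂)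
open import Function using (_∘_)
open import Relation.Binary.PropositionalEquality
  using (_≡_; refl; sym; trans; cong; module ≡-Reasoning)

open import Defs

Recurrent₃ : ℤ → ℤ → ℤ → (ℕ → ℤ) → Set
Recurrent₃ α β γ s = ∀ n → s (3 ℕ.+ n) ≡ α * s (2 ℕ.+ n) + β * s (1 ℕ.+ n) - γ * s n

Recurrent₃-unique : ∀ {α β γ} {s t : ℕ → ℤ} →
  Recurrent₃ α β γ s → Recurrent₃ α β γ t →
  s 0 ≡ t 0 → s 1 ≡ t 1 → s 2 ≡ t 2 → ∀ n → s n ≡ t n
Recurrent₃-unique {α} {β} {γ} {s} {t} rec-s rec-t s₀ s₁ s₂ n = proj₁ (window n)
  where
  combine : ∀ {x₀ x₁ x₂ y₀ y₁ y₂} → x₀ ≡ y₀ → x₁ ≡ y₁ → x₂ ≡ y₂ →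
    α * x₂ + β * x₁ - γ * x₀ ≡ α * y₂ + β * y₁ - γ * y₀
  combine refl refl refl = refl

  window : ∀ n → s n ≡ t n × s (1 ℕ.+ n) ≡ t (1 ℕ.+ n) × s (2 ℕ.+ n) ≡ t (2 ℕ.+ n)
  window zero    = s₀ , s₁ , s₂
  window (suc n) with window n
  ... | e₀ , e₁ , e₂ = e₁ , e₂ , e₃
    where
    open ≡-Reasoning
    e₃ : s (3 ℕ.+ n) ≡ t (3 ℕ.+ n)
    e₃ = begin
      s (3 ℕ.+ n)                                  ≡⟨ rec-s n ⟩
      α * s (2 ℕ.+ n) + β * s (1 ℕ.+ n) - γ * s n  ≡⟨ combine e₀ e₁ e₂ ⟩
      α * t (2 ℕ.+ n) + β * t (1 ℕ.+ n) - γ * t n  ≡⟨ sym (rec-t n) ⟩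
      t (3 ℕ.+ n)                                  ∎

coeffDiv-recurrent : ∀ N → (∀ n → coeffP N (3 ℕ.+ n) ≡ + 0) →
  Recurrent₃ (+ 28) (+ 84) (+ 27) (coeffDiv N)
coeffDiv-recurrent N deg≤2 n = begin
  coeffP N (3 ℕ.+ n) + + 28 * s₂ + + 84 * s₁ - + 27 * s₀
    ≡⟨ cong (λ k → k + + 28 * s₂ + + 84 * s₁ - + 27 * s₀) (deg≤2 n) ⟩
  + 0 + + 28 * s₂ + + 84 * s₁ - + 27 * s₀
    ≡⟨ cong (λ k → k + + 84 * s₁ - + 27 * s₀) (+-identityˡ (+ 28 * s₂)) ⟩
  + 28 * s₂ + + 84 * s₁ - + 27 * s₀
    ∎
  where
  open ≡-Reasoning
  s₀ s₁ s₂ : ℤ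
  s₀ = coeffDiv N n
  s₁ = coeffDiv N (1 ℕ.+ n)
  s₂ = coeffDiv N (2 ℕ.+ n)

quadForm : ℤ → ℤ → ℤ → ℤ × ℤ → ℤ
quadForm p q r (x , y) = p * (x * x) + q * (x * y) + r * (y * y)

-- The identities are stated through local lets, which are inlined, so that the
-- ring solver sees plain polynomials rather than calls to quadForm.
quadForm-shift-identity : ∀ P Q p q r u₀ u₁ →
  let F : ℤ → ℤ → ℤ
      F s t = p * (s * s) + q * (s * t) + r * (t * t)
      u₂ = P * u₁ + Q * u₀
      u₃ = P * u₂ + Q * u₁
      u₄ = P * u₃ + Q * u₂
  in F u₃ u₄ ≡ (P * P + Q) * F u₂ u₃ + Q * (P * P + Q) * F u₁ u₂ - Q * Q * Q * F u₀ u₁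
quadForm-shift-identity = solve-∀

cassini-shift-identity : ∀ P Q u₀ u₁ →
  let F : ℤ → ℤ → ℤ
      F s t = - Q * (s * s) + - P * (s * t) + + 1 * (t * t)
  in F u₁ (P * u₁ + Q * u₀) ≡ - Q * F u₀ u₁
cassini-shift-identity = solve-∀

module PairRecurrence (P Q : ℤ) where

  next : ℤ × ℤ → ℤ × ℤ
  next (x , y) = y , P * y + Q * x

  orbit : ℤ × ℤ → ℕ → ℤ × ℤ
  orbit v = fold v next

  quadForm-orbit-recurrent : ∀ p q r v →
    Recurrent₃ (P * P + Q) (Q * (P * P + Q)) (Q * Q * Q) (quadForm p q r ∘ orbit v)
  quadForm-orbit-recurrent p q r v n with orbit v n
  ... | u₀ , u₁ = quadForm-shift-identity P Q p q r u₀ u₁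

  cassini : ℤ × ℤ → ℤ
  cassini = quadForm (- Q) (- P) (+ 1)

  cassini-next : ∀ v → cassini (next v) ≡ - Q * cassini v
  cassini-next (u₀ , u₁) = cassini-shift-identity P Q u₀ u₁

  cassini-orbit : ∀ v n → cassini (orbit v n) ≡ (- Q) ^ n * cassini v
  cassini-orbit v zero    = sym (*-identityˡ (cassini v))
  cassini-orbit v (suc n) = begin
    cassini (next (orbit v n))          ≡⟨ cassini-next (orbit v n) ⟩
    - Q * cassini (orbit v n)           ≡⟨ cong (- Q *_) (cassini-orbit v n) ⟩
    - Q * ((- Q) ^ n * cassini v)       ≡⟨ sym (*-assoc (- Q) ((- Q) ^ n) (cassini v)) ⟩
    (- Q) ^ suc n * cassini v           ∎
    where open ≡-Reasoning

quartic-identity : ∀ x y →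
  let F : ℤ → ℤ → ℤ → ℤ
      F p q r = p * (x * x) + q * (x * y) + r * (y * y)
      _⁴ : ℤ → ℤ  -- t ^ 4 unfolded: the ring solver does not read ℤ's _^_
      t ⁴ = t * (t * (t * (t * + 1)))
  in F (- + 18) (+ 44) (+ 6) ⁴ + F (- + 42) (+ 4) (+ 14) ⁴
       + F (+ 27) (+ 0) (+ 9) ⁴ + F (+ 12) (+ 0) (+ 4) ⁴
     ≡ F (+ 45) (+ 0) (+ 15) ⁴ - (+ 8 * F (- + 3) (- + 5) (+ 1)) ⁴
quartic-identity = solve-∀

open PairRecurrence (+ 5) (+ 3)

-- U n = (u (n-1) , u n), where u₋₁ = 0 and u₀ = 1.
U : ℕ → ℤ × ℤ
U = orbit (+ 0 , + 1)

coeffDiv≡quadForm : ∀ N p q r → (∀ n → coeffP N (3 ℕ.+ n) ≡ + 0) →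
  coeffDiv N 0 ≡ quadForm p q r (U 0) →
  coeffDiv N 1 ≡ quadForm p q r (U 1) →
  coeffDiv N 2 ≡ quadForm p q r (U 2) →
  ∀ n → coeffDiv N n ≡ quadForm p q r (U n)
coeffDiv≡quadForm N p q r deg≤2 =
  Recurrent₃-unique {+ 28} {+ 84} {+ 27}
    (coeffDiv-recurrent N deg≤2) (quadForm-orbit-recurrent p q r (+ 0 , + 1))

a≡quadForm : ∀ n → a n ≡ quadForm (- + 18) (+ 44) (+ 6) (U n)
a≡quadForm = coeffDiv≡quadForm _ (- + 18) (+ 44) (+ 6) (λ _ → refl) refl refl refl

b≡quadForm : ∀ n → b n ≡ quadForm (- + 42) (+ 4) (+ 14) (U n)
b≡quadForm = coeffDiv≡quadForm _ (- + 42) (+ 4) (+ 14) (λ _ → refl) refl refl refl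

c≡quadForm : ∀ n → c n ≡ quadForm (+ 27) (+ 0) (+ 9) (U n)
c≡quadForm = coeffDiv≡quadForm _ (+ 27) (+ 0) (+ 9) (λ _ → refl) refl refl refl

d≡quadForm : ∀ n → d n ≡ quadForm (+ 12) (+ 0) (+ 4) (U n)
d≡quadForm = coeffDiv≡quadForm _ (+ 12) (+ 0) (+ 4) (λ _ → refl) refl refl refl

e≡quadForm : ∀ n → e n ≡ quadForm (+ 45) (+ 0) (+ 15) (U n)
e≡quadForm = coeffDiv≡quadForm _ (+ 45) (+ 0) (+ 15) (λ _ → refl) refl refl refl

[-3]^n≡cassini : ∀ n → (- + 3) ^ n ≡ cassini (U n)
[-3]^n≡cassini n = sym (trans (cassini-orbit (+ 0 , + 1) n) (*-identityʳ ((- + 3) ^ n)))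

quartic-quadForm : ∀ {A B C D E K} v →
  A ≡ quadForm (- + 18) (+ 44) (+ 6) v → B ≡ quadForm (- + 42) (+ 4) (+ 14) v →
  C ≡ quadForm (+ 27) (+ 0) (+ 9) v → D ≡ quadForm (+ 12) (+ 0) (+ 4) v →
  E ≡ quadForm (+ 45) (+ 0) (+ 15) v → K ≡ cassini v →
  A ^ 4 + B ^ 4 + C ^ 4 + D ^ 4 ≡ E ^ 4 - (+ 8 * K) ^ 4
quartic-quadForm (x , y) refl refl refl refl refl refl = quartic-identity x y

theorem2p7 : (n : ℕ) → a n ^ 4 + b n ^ 4 + c n ^ 4 + d n ^ 4 ≡ e n ^ 4 - ((+ 8) * (- (+ 3)) ^ n) ^ 4
theorem2p7 n = quartic-quadForm (U n)
  (a≡quadForm n) (b≡quadForm n) (c≡quadForm n) (d≡quadForm n) (e≡quadForm n) ([-3]^n≡cassini n)
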